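{- Let $T$ be a binary tree with root $\rho$ and leaf labeling $\varphi:L(T)\to\{0,1\}$, and let $B$ be the set function produced by Part 1 of Fitch's algorithm. Suppose that for all $u,v\in V(T)$ with $v$ a child of $u$, $B(v)=\{0,1\}$ implies $B(u)=\{0,1\}$. Then every most parsimonious labeling $\varphi':V(T)\to\{0,1\}$ extending $\varphi$ is a Fitch solution; that is, Fitch's algorithm finds all most parsimonious labelings extending $\varphi$.
   Context: A binary tree is rooted with every non-leaf vertex having exactly two children. A most parsimonious labeling extending $\varphi$ is a map $\varphi':V(T)\to\{0,1\}$ agreeing with $\varphi$ on leaves and minimizing the number of edges $uv$ with $\varphi'(u)\ne\varphi'(v)$. Fitch's algorithm: Part 1: for each leaf $\ell$ set $B(\ell)=\{\varphi(\ell)\}$; for a vertex $u$ with children $v_1,v_2$ set $B(u)=B(v_1)\cap B(v_2)$ if this is nonempty and $B(u)=B(v_1)\cup B(v_2)$ otherwise. Part 2: choose $\alpha\in B(\rho)$ and set $\varphi'(\rho)=\alpha$; recursively, for $v$ a child of $u$, set $\varphi'(v)=\varphi'(u)$ if $\varphi'(u)\in B(v)$ and $\varphi'(v)=1-\varphi'(u)$ otherwise. A labeling obtained by Part 2 for some choice of $\alpha\in B(\rho)$ is called a Fitch solution. -}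

module Defs where

open import Data.Bool using (Bool; true; false; not; if_then_else_; _∧_; _∨_)
open import Data.Nat using (ℕ; zero; suc; _+_; _≤_)
open import Data.Product using (_×_; _,_; Σ; ∃)
open import Relation.Binary.PropositionalEquality using (_≡_)

data Tree : Set where
  leaf : Tree
  node : Tree → Tree → Tree

-- Vertices V(T), addressed by their path from the root ρ = here.
data Pos : Tree → Set where
  here  : ∀ {t} → Pos t
  left  : ∀ {l r} → Pos l → Pos (node l r)
  right : ∀ {l r} → Pos r → Pos (node l r)

data LeafPos : Tree → Set where
  atLeaf : LeafPos leaf
  leftL  : ∀ {l r} → LeafPos l → LeafPos (node l r)
  rightL : ∀ {l r} → LeafPos r → LeafPos (node l r)

leafToPos : ∀ {t} → LeafPos t → Pos t
leafToPos atLeaf     = here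
leafToPos (leftL p)  = left (leafToPos p)
leafToPos (rightL p) = right (leafToPos p)

data _isChildOf_ : ∀ {t} → Pos t → Pos t → Set where
  childL : ∀ {l r} → left {l} {r} here isChildOf here
  childR : ∀ {l r} → right {l} {r} here isChildOf here
  inL    : ∀ {l r} {v u : Pos l} → v isChildOf u → left {l} {r} v isChildOf left u
  inR    : ∀ {l r} {v u : Pos r} → v isChildOf u → right {l} {r} v isChildOf right u

-- Labelings of vertices / leaves with {0,1} (0 = false, 1 = true)
Labeling : Tree → Set
Labeling t = Pos t → Bool

LeafLabeling : Tree → Set
LeafLabeling t = LeafPos t → Bool

Extends : ∀ {t} → Labeling t → LeafLabeling t → Set
Extends {t} φ' φ = (ℓ : LeafPos t) → φ' (leafToPos ℓ) ≡ φ ℓ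

diff : Bool → Bool → ℕ
diff false false = 0
diff true  true  = 0
diff _     _     = 1

changes : (t : Tree) → Labeling t → ℕ
changes leaf         f = 0
changes (node l r) f =
  diff (f here) (f (left here)) + diff (f here) (f (right here))
  + changes l (λ p → f (left p)) + changes r (λ p → f (right p))

MostParsimonious : ∀ {t} → LeafLabeling t → Labeling t → Set
MostParsimonious {t} φ φ' =
  Extends φ' φ × ((ψ : Labeling t) → Extends ψ φ → changes t φ' ≤ changes t ψ)

record Sub : Set where
  constructor sub
  field
    has0 : Bool
    has1 : Bool
open Sub public

_∈ₛ_ : Bool → Sub → Bool
false ∈ₛ S = has0 S
true  ∈ₛ S = has1 S

singleton : Bool → Sub
singleton false = sub true false
singleton true  = sub false true

full : Sub
full = sub true true

_∩_ : Sub → Sub → Sub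
sub a b ∩ sub c d = sub (a ∧ c) (b ∧ d)

_∪_ : Sub → Sub → Sub
sub a b ∪ sub c d = sub (a ∨ c) (b ∨ d)

nonempty : Sub → Bool
nonempty (sub a b) = a ∨ b

fitchStep : Sub → Sub → Sub
fitchStep S₁ S₂ = if nonempty (S₁ ∩ S₂) then S₁ ∩ S₂ else S₁ ∪ S₂

Broot : (t : Tree) → LeafLabeling t → Sub
Broot leaf       φ = singleton (φ atLeaf)
Broot (node l r) φ = fitchStep (Broot l (λ p → φ (leftL p))) (Broot r (λ p → φ (rightL p)))

B : (t : Tree) → LeafLabeling t → Pos t → Sub
B t          φ here      = Broot t φ
B (node l r) φ (left p)  = B l (λ q → φ (leftL q)) p
B (node l r) φ (right p) = B r (λ q → φ (rightL q)) p

childLabel : Bool → Sub → Bool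
childLabel a S = if a ∈ₛ S then a else not a

fitchPart2 : (t : Tree) → LeafLabeling t → Bool → Labeling t
fitchPart2 t          φ a here      = a
fitchPart2 (node l r) φ a (left p)  =
  fitchPart2 l (λ q → φ (leftL q)) (childLabel a (Broot l (λ q → φ (leftL q)))) p
fitchPart2 (node l r) φ a (right p) =
  fitchPart2 r (λ q → φ (rightL q)) (childLabel a (Broot r (λ q → φ (rightL q)))) p

FitchSolution : (t : Tree) → LeafLabeling t → Labeling t → Set
FitchSolution t φ φ' =
  Σ Bool λ α → (α ∈ₛ Broot t φ ≡ true) × ((p : Pos t) → φ' p ≡ fitchPart2 t φ α p)

-- Part 1 of Fitch's algorithm is a dynamic program for the cost of a subtree hung below a
-- parent of label a: over labelings extending φ, its minimum is score + [a ∉ B(ρ)], where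
-- score counts the unions taken in Part 1, and Part 2 attains it. Hence the restriction of a
-- most parsimonious labeling to a subtree is optimal for the label a of its parent, which
-- forces the root of the subtree to be labelled a when a ∈ B and not a otherwise, except that
-- a root label a ∉ B might tie with not a. The hypothesis rules this tie out: B is then not
-- full, so neither are the sets of the two children, hence both equal {not a}, and relabelling
-- the root with not a saves an edge.
module Submission where

open import Defs
open import Data.Bool using (Bool; true; false; not; if_then_else_)
open import Data.Bool.Properties using (_≟_; ¬-not)
open import Data.Empty using (⊥-elim)
open import Data.Nat using (ℕ; _+_; _≤_; _<_; _≤?_; z≤n)
open import Data.Nat.Properties hiding (_≟_)
open import Algebra.Properties.CommutativeSemigroup +-commutativeSemigroup
  using () renaming (interchange to +-interchange; x∙yz≈y∙xz to m+[n+o]≡n+[m+o])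
open import Data.Product using (_,_; proj₁)
open import Function using (_∘_)
open import Relation.Binary.PropositionalEquality
  using (_≡_; _≢_; refl; sym; trans; cong; cong₂; subst; module ≡-Reasoning)
open import Relation.Nullary using (¬_; yes; no)
open import Relation.Nullary.Decidable using (True; toWitness)

≤-byEval : ∀ {m n} {m≤n : True (m ≤? n)} → m ≤ n
≤-byEval {m≤n = m≤n} = toWitness m≤n

NonEmpty : Sub → Set
NonEmpty S = nonempty S ≡ true

penalty : Sub → Bool → ℕ
penalty S a = if a ∈ₛ S then 0 else 1

gap : Sub → Sub → ℕ
gap S₁ S₂ = if nonempty (S₁ ∩ S₂) then 0 else 1

diff-refl : ∀ a → diff a a ≡ 0
diff-refl false = refl
diff-refl true  = refl

diff-not : ∀ a → diff a (not a) ≡ 1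
diff-not false = refl
diff-not true  = refl

diff-≢ : ∀ {a b} → a ≢ b → diff a b ≡ 1
diff-≢ {false} {false} a≢b = ⊥-elim (a≢b refl)
diff-≢ {false} {true}  _   = refl
diff-≢ {true}  {false} _   = refl
diff-≢ {true}  {true}  a≢b = ⊥-elim (a≢b refl)

penalty-∈ : ∀ {a S} → a ∈ₛ S ≡ true → penalty S a ≡ 0
penalty-∈ a∈S rewrite a∈S = refl

penalty≤1 : ∀ S a → penalty S a ≤ 1
penalty≤1 S a with a ∈ₛ S
... | true  = z≤n
... | false = ≤-refl

penalty-singleton : ∀ x a → penalty (singleton x) a ≡ diff a x
penalty-singleton false false = refl
penalty-singleton false true  = refl
penalty-singleton true  false = refl
penalty-singleton true  true  = refl

∈-singleton : ∀ {a x} → a ≡ x → a ∈ₛ singleton x ≡ true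
∈-singleton {false} refl = refl
∈-singleton {true}  refl = refl

∉⇒≢full : ∀ {a S} → a ∈ₛ S ≡ false → S ≢ full
∉⇒≢full {false} () refl
∉⇒≢full {true}  () refl

childLabel-singleton : ∀ a x → childLabel a (singleton x) ≡ x
childLabel-singleton false false = refl
childLabel-singleton false true  = refl
childLabel-singleton true  false = refl
childLabel-singleton true  true  = refl

childLabel-member : ∀ {S} a → NonEmpty S → childLabel a S ∈ₛ S ≡ true
childLabel-member {sub false false} a     ()
childLabel-member {sub true  _}     false _ = refl
childLabel-member {sub false true}  false _ = refl
childLabel-member {sub _     true}  true  _ = refl
childLabel-member {sub true  false} true  _ = refl

diff-childLabel : ∀ a S → diff a (childLabel a S) ≡ penalty S a
diff-childLabel a S with a ∈ₛ S
... | true  = diff-refl a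
... | false = diff-not a

penalty-triangle : ∀ S a c → penalty S a ≤ diff a c + penalty S c
penalty-triangle S false false = ≤-refl
penalty-triangle S true  true  = ≤-refl
penalty-triangle S false true  = ≤-trans (penalty≤1 S false) (m≤m+n 1 _)
penalty-triangle S true  false = ≤-trans (penalty≤1 S true) (m≤m+n 1 _)

fitchStep-nonEmpty : ∀ S₁ S₂ → NonEmpty S₁ → NonEmpty S₂ → NonEmpty (fitchStep S₁ S₂)
fitchStep-nonEmpty (sub false false) _ () _
fitchStep-nonEmpty _ (sub false false) _ ()
fitchStep-nonEmpty (sub false true) (sub false true) _ _ = refl
fitchStep-nonEmpty (sub false true) (sub true false) _ _ = refl
fitchStep-nonEmpty (sub false true) (sub true true)  _ _ = refl
fitchStep-nonEmpty (sub true false) (sub false true) _ _ = refl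
fitchStep-nonEmpty (sub true false) (sub true false) _ _ = refl
fitchStep-nonEmpty (sub true false) (sub true true)  _ _ = refl
fitchStep-nonEmpty (sub true true)  (sub false true) _ _ = refl
fitchStep-nonEmpty (sub true true)  (sub true false) _ _ = refl
fitchStep-nonEmpty (sub true true)  (sub true true)  _ _ = refl

fitchStep-penalty-≤ : ∀ S₁ S₂ c → NonEmpty S₁ → NonEmpty S₂ →
  gap S₁ S₂ + penalty (fitchStep S₁ S₂) c ≤ penalty S₁ c + penalty S₂ c
fitchStep-penalty-≤ (sub false false) _ _ () _
fitchStep-penalty-≤ _ (sub false false) _ _ ()
fitchStep-penalty-≤ (sub false true) (sub false true) false _ _ = ≤-byEval
fitchStep-penalty-≤ (sub false true) (sub false true) true  _ _ = ≤-byEval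
fitchStep-penalty-≤ (sub false true) (sub true false) false _ _ = ≤-byEval
fitchStep-penalty-≤ (sub false true) (sub true false) true  _ _ = ≤-byEval
fitchStep-penalty-≤ (sub false true) (sub true true)  false _ _ = ≤-byEval
fitchStep-penalty-≤ (sub false true) (sub true true)  true  _ _ = ≤-byEval
fitchStep-penalty-≤ (sub true false) (sub false true) false _ _ = ≤-byEval
fitchStep-penalty-≤ (sub true false) (sub false true) true  _ _ = ≤-byEval
fitchStep-penalty-≤ (sub true false) (sub true false) false _ _ = ≤-byEval
fitchStep-penalty-≤ (sub true false) (sub true false) true  _ _ = ≤-byEval
fitchStep-penalty-≤ (sub true false) (sub true true)  false _ _ = ≤-byEval
fitchStep-penalty-≤ (sub true false) (sub true true)  true  _ _ = ≤-byEval
fitchStep-penalty-≤ (sub true true)  (sub false true) false _ _ = ≤-byEval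
fitchStep-penalty-≤ (sub true true)  (sub false true) true  _ _ = ≤-byEval
fitchStep-penalty-≤ (sub true true)  (sub true false) false _ _ = ≤-byEval
fitchStep-penalty-≤ (sub true true)  (sub true false) true  _ _ = ≤-byEval
fitchStep-penalty-≤ (sub true true)  (sub true true)  false _ _ = ≤-byEval
fitchStep-penalty-≤ (sub true true)  (sub true true)  true  _ _ = ≤-byEval

penalty-fitchStep-∈ : ∀ S₁ S₂ c → NonEmpty S₁ → NonEmpty S₂ → c ∈ₛ fitchStep S₁ S₂ ≡ true →
  penalty S₁ c + penalty S₂ c ≡ gap S₁ S₂
penalty-fitchStep-∈ (sub false false) _ _ () _ _
penalty-fitchStep-∈ _ (sub false false) _ _ () _
penalty-fitchStep-∈ (sub false true) (sub false true) false _ _ ()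
penalty-fitchStep-∈ (sub false true) (sub false true) true  _ _ _ = refl
penalty-fitchStep-∈ (sub false true) (sub true false) false _ _ _ = refl
penalty-fitchStep-∈ (sub false true) (sub true false) true  _ _ _ = refl
penalty-fitchStep-∈ (sub false true) (sub true true)  false _ _ ()
penalty-fitchStep-∈ (sub false true) (sub true true)  true  _ _ _ = refl
penalty-fitchStep-∈ (sub true false) (sub false true) false _ _ _ = refl
penalty-fitchStep-∈ (sub true false) (sub false true) true  _ _ _ = refl
penalty-fitchStep-∈ (sub true false) (sub true false) false _ _ _ = refl
penalty-fitchStep-∈ (sub true false) (sub true false) true  _ _ ()
penalty-fitchStep-∈ (sub true false) (sub true true)  false _ _ _ = refl
penalty-fitchStep-∈ (sub true false) (sub true true)  true  _ _ ()
penalty-fitchStep-∈ (sub true true)  (sub false true) false _ _ ()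
penalty-fitchStep-∈ (sub true true)  (sub false true) true  _ _ _ = refl
penalty-fitchStep-∈ (sub true true)  (sub true false) false _ _ _ = refl
penalty-fitchStep-∈ (sub true true)  (sub true false) true  _ _ ()
penalty-fitchStep-∈ (sub true true)  (sub true true)  false _ _ _ = refl
penalty-fitchStep-∈ (sub true true)  (sub true true)  true  _ _ _ = refl

fitchStep-penalty-< : ∀ S₁ S₂ c → NonEmpty S₁ → NonEmpty S₂ → S₁ ≢ full → S₂ ≢ full →
  c ∈ₛ fitchStep S₁ S₂ ≡ false → gap S₁ S₂ + penalty (fitchStep S₁ S₂) c < penalty S₁ c + penalty S₂ c
fitchStep-penalty-< (sub false false) _ _ () _ _ _ _
fitchStep-penalty-< _ (sub false false) _ _ () _ _ _
fitchStep-penalty-< (sub true true) _ _ _ _ S₁≢full _ _ = ⊥-elim (S₁≢full refl)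
fitchStep-penalty-< _ (sub true true) _ _ _ _ S₂≢full _ = ⊥-elim (S₂≢full refl)
fitchStep-penalty-< (sub false true) (sub false true) false _ _ _ _ _ = ≤-byEval
fitchStep-penalty-< (sub false true) (sub false true) true  _ _ _ _ ()
fitchStep-penalty-< (sub false true) (sub true false) false _ _ _ _ ()
fitchStep-penalty-< (sub false true) (sub true false) true  _ _ _ _ ()
fitchStep-penalty-< (sub true false) (sub false true) false _ _ _ _ ()
fitchStep-penalty-< (sub true false) (sub false true) true  _ _ _ _ ()
fitchStep-penalty-< (sub true false) (sub true false) false _ _ _ _ ()
fitchStep-penalty-< (sub true false) (sub true false) true  _ _ _ _ _ = ≤-byEval

singleton-nonEmpty : ∀ x → NonEmpty (singleton x)
singleton-nonEmpty false = refl
singleton-nonEmpty true  = refl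

Broot-nonEmpty : ∀ t φ → NonEmpty (Broot t φ)
Broot-nonEmpty leaf       φ = singleton-nonEmpty (φ atLeaf)
Broot-nonEmpty (node l r) φ =
  fitchStep-nonEmpty (Broot l (φ ∘ leftL)) (Broot r (φ ∘ rightL))
    (Broot-nonEmpty l (φ ∘ leftL)) (Broot-nonEmpty r (φ ∘ rightL))

score : (t : Tree) → LeafLabeling t → ℕ
score leaf       φ = 0
score (node l r) φ =
  (score l (φ ∘ leftL) + score r (φ ∘ rightL)) + gap (Broot l (φ ∘ leftL)) (Broot r (φ ∘ rightL))

plantedChanges : (t : Tree) → Bool → Labeling t → ℕ
plantedChanges t a f = diff a (f here) + changes t f

PlantedOptimal : (t : Tree) → LeafLabeling t → Bool → Labeling t → Set
PlantedOptimal t φ a f = (g : Labeling t) → Extends g φ → plantedChanges t a f ≤ plantedChanges t a g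

FullPropagates : (t : Tree) → LeafLabeling t → Set
FullPropagates t φ = (u v : Pos t) → v isChildOf u → B t φ v ≡ full → B t φ u ≡ full

fitchBelow : (t : Tree) → LeafLabeling t → Bool → Labeling t
fitchBelow t φ a = fitchPart2 t φ (childLabel a (Broot t φ))

graft : ∀ {l r} → Bool → Labeling l → Labeling r → Labeling (node l r)
graft c f g here      = c
graft c f g (left p)  = f p
graft c f g (right p) = g p

graft-extends : ∀ {l r φ c} {f : Labeling l} {g : Labeling r} →
  Extends f (φ ∘ leftL) → Extends g (φ ∘ rightL) → Extends (graft c f g) φ
graft-extends f-ext g-ext (leftL ℓ)  = f-ext ℓ
graft-extends f-ext g-ext (rightL ℓ) = g-ext ℓ

changes-node : ∀ {l r} (f : Labeling (node l r)) →
  changes (node l r) f ≡ plantedChanges l (f here) (f ∘ left) + plantedChanges r (f here) (f ∘ right)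
changes-node {l} {r} f =
  trans (+-assoc (dˡ + dʳ) (changes l (f ∘ left)) (changes r (f ∘ right)))
        (+-interchange dˡ dʳ (changes l (f ∘ left)) (changes r (f ∘ right)))
  where
  dˡ = diff (f here) (f (left here))
  dʳ = diff (f here) (f (right here))

fitchBelow-extends : ∀ t φ a → Extends (fitchBelow t φ a) φ
fitchBelow-extends leaf       φ a atLeaf     = childLabel-singleton a (φ atLeaf)
fitchBelow-extends (node l r) φ a (leftL ℓ)  =
  fitchBelow-extends l (φ ∘ leftL) (childLabel a (Broot (node l r) φ)) ℓ
fitchBelow-extends (node l r) φ a (rightL ℓ) =
  fitchBelow-extends r (φ ∘ rightL) (childLabel a (Broot (node l r) φ)) ℓ

fitchStep-edge-lower : ∀ S₁ S₂ a c → NonEmpty S₁ → NonEmpty S₂ →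
  gap S₁ S₂ + penalty (fitchStep S₁ S₂) a ≤ diff a c + (penalty S₁ c + penalty S₂ c)
fitchStep-edge-lower S₁ S₂ a c ne₁ ne₂ = begin
  gap S₁ S₂ + penalty S a                ≤⟨ +-monoʳ-≤ (gap S₁ S₂) (penalty-triangle S a c) ⟩
  gap S₁ S₂ + (diff a c + penalty S c)   ≡⟨ m+[n+o]≡n+[m+o] (gap S₁ S₂) (diff a c) (penalty S c) ⟩
  diff a c + (gap S₁ S₂ + penalty S c)   ≤⟨ +-monoʳ-≤ (diff a c) (fitchStep-penalty-≤ S₁ S₂ c ne₁ ne₂) ⟩
  diff a c + (penalty S₁ c + penalty S₂ c) ∎
  where
  open ≤-Reasoning
  S = fitchStep S₁ S₂

fitchBelow-cost : ∀ t φ a → plantedChanges t a (fitchBelow t φ a) ≡ score t φ + penalty (Broot t φ) a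
fitchBelow-cost leaf φ a = trans (+-identityʳ _) (diff-childLabel a (singleton (φ atLeaf)))
fitchBelow-cost (node l r) φ a = begin
  diff a c + changes (node l r) f
    ≡⟨ cong₂ _+_ (diff-childLabel a S) (changes-node f) ⟩
  penalty S a + (plantedChanges l c (f ∘ left) + plantedChanges r c (f ∘ right))
    ≡⟨ cong (penalty S a +_) (cong₂ _+_ (fitchBelow-cost l φˡ c) (fitchBelow-cost r φʳ c)) ⟩
  penalty S a + ((sˡ + penalty Sˡ c) + (sʳ + penalty Sʳ c))
    ≡⟨ cong (penalty S a +_) (+-interchange sˡ (penalty Sˡ c) sʳ (penalty Sʳ c)) ⟩
  penalty S a + ((sˡ + sʳ) + (penalty Sˡ c + penalty Sʳ c))
    ≡⟨ cong (λ k → penalty S a + ((sˡ + sʳ) + k)) penalties≡gap ⟩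
  penalty S a + score (node l r) φ
    ≡⟨ +-comm (penalty S a) _ ⟩
  score (node l r) φ + penalty S a ∎
  where
  open ≡-Reasoning
  φˡ = φ ∘ leftL
  φʳ = φ ∘ rightL
  Sˡ = Broot l φˡ
  Sʳ = Broot r φʳ
  sˡ = score l φˡ
  sʳ = score r φʳ
  S = Broot (node l r) φ
  c = childLabel a S
  f = fitchBelow (node l r) φ a
  penalties≡gap : penalty Sˡ c + penalty Sʳ c ≡ gap Sˡ Sʳ
  penalties≡gap = penalty-fitchStep-∈ Sˡ Sʳ c (Broot-nonEmpty l φˡ) (Broot-nonEmpty r φʳ)
    (childLabel-member a (Broot-nonEmpty (node l r) φ))

mutual
  score-lower : ∀ t φ (χ : Labeling t) → Extends χ φ → ∀ a →
    score t φ + penalty (Broot t φ) a ≤ plantedChanges t a χ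
  score-lower leaf φ χ χ-ext a = ≤-reflexive (begin
    penalty (singleton (φ atLeaf)) a ≡⟨ penalty-singleton (φ atLeaf) a ⟩
    diff a (φ atLeaf)                ≡⟨ cong (diff a) (χ-ext atLeaf) ⟨
    diff a (χ here)                  ≡⟨ +-identityʳ _ ⟨
    diff a (χ here) + 0              ∎)
    where open ≡-Reasoning
  score-lower (node l r) φ χ χ-ext a = begin
    ((sˡ + sʳ) + gap Sˡ Sʳ) + penalty S a
      ≡⟨ +-assoc (sˡ + sʳ) (gap Sˡ Sʳ) (penalty S a) ⟩
    (sˡ + sʳ) + (gap Sˡ Sʳ + penalty S a)
      ≤⟨ +-monoʳ-≤ (sˡ + sʳ)
           (fitchStep-edge-lower Sˡ Sʳ a c (Broot-nonEmpty l φˡ) (Broot-nonEmpty r φʳ)) ⟩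
    (sˡ + sʳ) + (diff a c + (penalty Sˡ c + penalty Sʳ c))
      ≡⟨ m+[n+o]≡n+[m+o] (sˡ + sʳ) (diff a c) _ ⟩
    diff a c + ((sˡ + sʳ) + (penalty Sˡ c + penalty Sʳ c))
      ≡⟨ cong (diff a c +_) (+-interchange sˡ sʳ (penalty Sˡ c) (penalty Sʳ c)) ⟩
    diff a c + ((sˡ + penalty Sˡ c) + (sʳ + penalty Sʳ c))
      ≤⟨ +-monoʳ-≤ (diff a c) (children-lower l r φ χ χ-ext) ⟩
    diff a c + changes (node l r) χ ∎
    where
    open ≤-Reasoning
    φˡ = φ ∘ leftL
    φʳ = φ ∘ rightL
    Sˡ = Broot l φˡ
    Sʳ = Broot r φʳ
    sˡ = score l φˡ
    sʳ = score r φʳ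
    S = Broot (node l r) φ
    c = χ here

  children-lower : ∀ l r φ (χ : Labeling (node l r)) → Extends χ φ →
    (score l (φ ∘ leftL) + penalty (Broot l (φ ∘ leftL)) (χ here))
      + (score r (φ ∘ rightL) + penalty (Broot r (φ ∘ rightL)) (χ here))
      ≤ changes (node l r) χ
  children-lower l r φ χ χ-ext =
    ≤-trans (+-mono-≤ (score-lower l (φ ∘ leftL) (χ ∘ left) (χ-ext ∘ leftL) (χ here))
                      (score-lower r (φ ∘ rightL) (χ ∘ right) (χ-ext ∘ rightL) (χ here)))
            (≤-reflexive (sym (changes-node χ)))

score-≤-changes : ∀ t φ (χ : Labeling t) → Extends χ φ → score t φ ≤ changes t χ
score-≤-changes t φ χ χ-ext = begin
  score t φ                                     ≤⟨ m≤m+n (score t φ) _ ⟩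
  score t φ + penalty (Broot t φ) (χ here)     ≤⟨ score-lower t φ χ χ-ext (χ here) ⟩
  diff (χ here) (χ here) + changes t χ          ≡⟨ cong (_+ changes t χ) (diff-refl (χ here)) ⟩
  changes t χ                                   ∎
  where open ≤-Reasoning

plantedOptimal-≤ : ∀ {t φ a} {ψ : Labeling t} → PlantedOptimal t φ a ψ →
  plantedChanges t a ψ ≤ score t φ + penalty (Broot t φ) a
plantedOptimal-≤ {t} {φ} {a} opt =
  ≤-trans (opt (fitchBelow t φ a) (fitchBelow-extends t φ a)) (≤-reflexive (fitchBelow-cost t φ a))

plantedOptimalˡ : ∀ {l r φ a} (ψ : Labeling (node l r)) → Extends ψ φ →
  PlantedOptimal (node l r) φ a ψ → PlantedOptimal l (φ ∘ leftL) (ψ here) (ψ ∘ left)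
plantedOptimalˡ {l} {r} {a = a} ψ ψ-ext opt χ χ-ext =
  +-cancelʳ-≤ (plantedChanges r (ψ here) (ψ ∘ right)) _ _ (begin
    plantedChanges l (ψ here) (ψ ∘ left) + plantedChanges r (ψ here) (ψ ∘ right)
      ≡⟨ changes-node ψ ⟨
    changes (node l r) ψ
      ≤⟨ +-cancelˡ-≤ (diff a (ψ here)) _ _ (opt ψ′ (graft-extends χ-ext (ψ-ext ∘ rightL))) ⟩
    changes (node l r) ψ′
      ≡⟨ changes-node ψ′ ⟩
    plantedChanges l (ψ here) χ + plantedChanges r (ψ here) (ψ ∘ right) ∎)
  where
  open ≤-Reasoning
  ψ′ = graft (ψ here) χ (ψ ∘ right)

plantedOptimalʳ : ∀ {l r φ a} (ψ : Labeling (node l r)) → Extends ψ φ →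
  PlantedOptimal (node l r) φ a ψ → PlantedOptimal r (φ ∘ rightL) (ψ here) (ψ ∘ right)
plantedOptimalʳ {l} {r} {a = a} ψ ψ-ext opt χ χ-ext =
  +-cancelˡ-≤ (plantedChanges l (ψ here) (ψ ∘ left)) _ _ (begin
    plantedChanges l (ψ here) (ψ ∘ left) + plantedChanges r (ψ here) (ψ ∘ right)
      ≡⟨ changes-node ψ ⟨
    changes (node l r) ψ
      ≤⟨ +-cancelˡ-≤ (diff a (ψ here)) _ _ (opt ψ′ (graft-extends (ψ-ext ∘ leftL) χ-ext)) ⟩
    changes (node l r) ψ′
      ≡⟨ changes-node ψ′ ⟩
    plantedChanges l (ψ here) (ψ ∘ left) + plantedChanges r (ψ here) χ ∎)
  where
  open ≤-Reasoning
  ψ′ = graft (ψ here) (ψ ∘ left) χ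

fullPropagatesˡ : ∀ {l r φ} → FullPropagates (node l r) φ → FullPropagates l (φ ∘ leftL)
fullPropagatesˡ H u v v◁u = H (left u) (left v) (inL v◁u)

fullPropagatesʳ : ∀ {l r φ} → FullPropagates (node l r) φ → FullPropagates r (φ ∘ rightL)
fullPropagatesʳ H u v v◁u = H (right u) (right v) (inR v◁u)

outsideRoot-¬plantedOptimal : ∀ t φ (ψ : Labeling t) → FullPropagates t φ → Extends ψ φ →
  ψ here ∈ₛ Broot t φ ≡ false → ¬ PlantedOptimal t φ (ψ here) ψ
outsideRoot-¬plantedOptimal leaf φ ψ _ ψ-ext b∉B _
  with trans (sym (∈-singleton (ψ-ext atLeaf))) b∉B
... | ()
outsideRoot-¬plantedOptimal (node x y) φ ψ H ψ-ext b∉B opt =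
  <⇒≱ fitch<ψ (opt (fitchBelow (node x y) φ b) (fitchBelow-extends (node x y) φ b))
  where
  open ≤-Reasoning
  b = ψ here
  φˣ = φ ∘ leftL
  φʸ = φ ∘ rightL
  Sˣ = Broot x φˣ
  Sʸ = Broot y φʸ
  sˣ = score x φˣ
  sʸ = score y φʸ
  Sˣ≢full : Sˣ ≢ full
  Sˣ≢full = ∉⇒≢full {b} b∉B ∘ H here (left here) childL
  Sʸ≢full : Sʸ ≢ full
  Sʸ≢full = ∉⇒≢full {b} b∉B ∘ H here (right here) childR
  fitch<ψ : plantedChanges (node x y) b (fitchBelow (node x y) φ b) < plantedChanges (node x y) b ψ
  fitch<ψ = begin-strict
    plantedChanges (node x y) b (fitchBelow (node x y) φ b)
      ≡⟨ fitchBelow-cost (node x y) φ b ⟩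
    ((sˣ + sʸ) + gap Sˣ Sʸ) + penalty (Broot (node x y) φ) b
      ≡⟨ +-assoc (sˣ + sʸ) (gap Sˣ Sʸ) _ ⟩
    (sˣ + sʸ) + (gap Sˣ Sʸ + penalty (Broot (node x y) φ) b)
      <⟨ +-monoʳ-< (sˣ + sʸ) (fitchStep-penalty-< Sˣ Sʸ b (Broot-nonEmpty x φˣ) (Broot-nonEmpty y φʸ)
                                Sˣ≢full Sʸ≢full b∉B) ⟩
    (sˣ + sʸ) + (penalty Sˣ b + penalty Sʸ b)
      ≡⟨ +-interchange sˣ sʸ (penalty Sˣ b) (penalty Sʸ b) ⟩
    (sˣ + penalty Sˣ b) + (sʸ + penalty Sʸ b)
      ≤⟨ children-lower x y φ ψ ψ-ext ⟩
    changes (node x y) ψ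
      ≡⟨ cong (_+ changes (node x y) ψ) (diff-refl b) ⟨
    plantedChanges (node x y) b ψ ∎

plantedOptimal-root-∈ : ∀ {t φ a} (ψ : Labeling t) → Extends ψ φ → PlantedOptimal t φ a ψ →
  a ∈ₛ Broot t φ ≡ true → ψ here ≡ a
plantedOptimal-root-∈ {t} {φ} {a} ψ ψ-ext opt a∈B with ψ here ≟ a
... | yes b≡a = b≡a
... | no  b≢a = ⊥-elim (<⇒≱ optimum<ψ (plantedOptimal-≤ opt))
  where
  open ≤-Reasoning
  optimum<ψ : score t φ + penalty (Broot t φ) a < plantedChanges t a ψ
  optimum<ψ = begin-strict
    score t φ + penalty (Broot t φ) a ≡⟨ cong (score t φ +_) (penalty-∈ {a} {Broot t φ} a∈B) ⟩
    score t φ + 0                     ≡⟨ +-identityʳ (score t φ) ⟩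
    score t φ                         ≤⟨ score-≤-changes t φ ψ ψ-ext ⟩
    changes t ψ                       <⟨ n<1+n (changes t ψ) ⟩
    1 + changes t ψ                   ≡⟨ cong (_+ changes t ψ) (diff-≢ (b≢a ∘ sym)) ⟨
    plantedChanges t a ψ              ∎

plantedOptimal-root-∉ : ∀ {t φ a} (ψ : Labeling t) → FullPropagates t φ → Extends ψ φ →
  PlantedOptimal t φ a ψ → a ∈ₛ Broot t φ ≡ false → ψ here ≡ not a
plantedOptimal-root-∉ {t} {φ} {a} ψ H ψ-ext opt a∉B with ψ here ≟ a
... | yes refl = ⊥-elim (outsideRoot-¬plantedOptimal t φ ψ H ψ-ext a∉B opt)
... | no  b≢a  = ¬-not b≢a

plantedOptimal-root : ∀ {t φ a} (ψ : Labeling t) → FullPropagates t φ → Extends ψ φ →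
  PlantedOptimal t φ a ψ → ψ here ≡ childLabel a (Broot t φ)
plantedOptimal-root {t} {φ} {a} ψ H ψ-ext opt with a ∈ₛ Broot t φ in a∈B
... | true  = plantedOptimal-root-∈ {a = a} ψ ψ-ext opt a∈B
... | false = plantedOptimal-root-∉ {a = a} ψ H ψ-ext opt a∈B

plantedOptimal-fitchBelow : ∀ t φ {a} (ψ : Labeling t) → FullPropagates t φ → Extends ψ φ →
  PlantedOptimal t φ a ψ → ∀ p → ψ p ≡ fitchBelow t φ a p
plantedOptimal-fitchBelow t φ {a} ψ H ψ-ext opt here = plantedOptimal-root {a = a} ψ H ψ-ext opt
plantedOptimal-fitchBelow (node l r) φ {a} ψ H ψ-ext opt (left p) = trans
  (plantedOptimal-fitchBelow l (φ ∘ leftL) (ψ ∘ left) (fullPropagatesˡ H) (ψ-ext ∘ leftL)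
    (plantedOptimalˡ {a = a} ψ ψ-ext opt) p)
  (cong (λ c → fitchBelow l (φ ∘ leftL) c p) (plantedOptimal-root {a = a} ψ H ψ-ext opt))
plantedOptimal-fitchBelow (node l r) φ {a} ψ H ψ-ext opt (right p) = trans
  (plantedOptimal-fitchBelow r (φ ∘ rightL) (ψ ∘ right) (fullPropagatesʳ H) (ψ-ext ∘ rightL)
    (plantedOptimalʳ {a = a} ψ ψ-ext opt) p)
  (cong (λ c → fitchBelow r (φ ∘ rightL) c p) (plantedOptimal-root {a = a} ψ H ψ-ext opt))

mostParsimonious-plantedOptimal : ∀ {t φ} {ψ : Labeling t} → MostParsimonious φ ψ →
  PlantedOptimal t φ (ψ here) ψ
mostParsimonious-plantedOptimal {t} {ψ = ψ} (_ , ψ-opt) χ χ-ext = begin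
  diff (ψ here) (ψ here) + changes t ψ ≡⟨ cong (_+ changes t ψ) (diff-refl (ψ here)) ⟩
  changes t ψ                          ≤⟨ ψ-opt χ χ-ext ⟩
  changes t χ                          ≤⟨ m≤n+m (changes t χ) _ ⟩
  plantedChanges t (ψ here) χ          ∎
  where open ≤-Reasoning

mainTheorem16 : (t : Tree) (φ : LeafLabeling t)
    → ((u v : Pos t) → v isChildOf u → B t φ v ≡ full → B t φ u ≡ full)
    → (φ' : Labeling t) → MostParsimonious φ φ' → FitchSolution t φ φ'
mainTheorem16 t φ H ψ ψ-mp =
  ψ here , root∈B , λ p → trans (ψ≡fitch p) (cong (λ c → fitchPart2 t φ c p) root-fixed)
  where
  ψ≡fitch : ∀ p → ψ p ≡ fitchBelow t φ (ψ here) p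
  ψ≡fitch = plantedOptimal-fitchBelow t φ ψ H (proj₁ ψ-mp) (mostParsimonious-plantedOptimal ψ-mp)
  root-fixed : childLabel (ψ here) (Broot t φ) ≡ ψ here
  root-fixed = sym (ψ≡fitch here)
  root∈B : ψ here ∈ₛ Broot t φ ≡ true
  root∈B = subst (λ c → c ∈ₛ Broot t φ ≡ true) root-fixed
    (childLabel-member (ψ here) (Broot-nonEmpty t φ))
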